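{- Let $\langle A_0;S_0;T_0;\theta_0\rangle\Longrightarrow^{*}\langle\emptyset;S_n;T_n;\theta_n\rangle$ be an $\textsc{AUnif}$ derivation to a final configuration and let $s\triangleq_x t\in A_0\cup S_0$. Then $x\theta_n\tau\in\mathcal{G}_{\mathtt{Abs}}(s,t)$ for every $\tau\in\Psi(T_n,S_n)$.
   Context: Terms are built over variables $\mathcal{V}$ and function symbols $\mathcal{F}$ containing a special constant $\star$ (wild card); $\mathcal{V}(t)$ is the variable set of $t$; $head(x)=x$, $head(f(t_1,\dots,t_n))=f$. Substitutions are postfix; $\mathit{Dom}(\sigma)=\{x\mid x\sigma\neq x\}$; $\mathit{Rvar}(\sigma)$ is the set of variables in its range. An absorption theory $\mathtt{Abs}$ is a finite union of axiom sets $\{f(x,\varepsilon_f)\approx\varepsilon_f, f(\varepsilon_f,x)\approx\varepsilon_f\}$ for pairwise distinct binary $f$; $f,\varepsilon_f$ are related absorption symbols; $\approx_{\mathtt{Abs}}$ the induced equality; $r\preceq_{\mathtt{Abs}}s$ iff $r\sigma\approx_{\mathtt{Abs}}s$ for some $\sigma$; $\mathcal{G}_{\mathtt{Abs}}(s,t)=\{r\mid r\preceq_{\mathtt{Abs}}s,\ r\preceq_{\mathtt{Abs}}t\}$. A term is in $\mathtt{Abs}$-normal form if no $\varepsilon_f$ occurs as an argument of $f$. An AUE is $s\triangleq_x t$ with label $x$; valid sets have pairwise distinct labels; wild AUE: a side is $\star$; solved AUE: $head(s)\neq head(t)$, not related absorption symbols, not wild. A configuration $\langle A;S;T;\theta\rangle$: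 $A$ valid set of AUEs, $S$ valid set of solved AUEs, $T$ valid set of wild AUEs, $\theta$ a substitution, all terms $\mathtt{Abs}$-normal, $labels(A),labels(S),labels(T),\mathit{Dom}(\theta)$ pairwise disjoint, $\mathit{Rvar}(\theta)=labels(A)\cup labels(S)\cup labels(T)$. Rules of $\textsc{AUnif}$ ($\uplus$ disjoint union; $y_i$ fresh; $f$ in Exp rules an absorption symbol): (Dec) $\langle\{f(s_1,\dots,s_n)\triangleq_x f(t_1,\dots,t_n)\}\uplus A;S;T;\theta\rangle\Longrightarrow\langle\{s_i\triangleq_{y_i}t_i\}_{i=1}^n\cup A;S;T;\theta\{x\mapsto f(y_1,\dots,y_n)\}\rangle$, $n\ge0$. (Sol) $\langle\{s\triangleq_x t\}\uplus A;S;T;\theta\rangle\Longrightarrow\langle A;\{s\triangleq_x t\}\cup S;T;\theta\rangle$ if $head(s)\neq head(t)$ and they are not related absorption symbols. (ExpLA1) $\langle\{\varepsilon_f\triangleq_x f(t_1,t_2)\}\uplus A;S;T;\theta\rangle\Longrightarrow\langle\{\varepsilon_f\triangleq_{y_1}t_1\}\cup A;S;\{\star\triangleq_{y_2}t_2\}\cup T;\theta\{x\mapsto f(y_1,y_2)\}\rangle$. (ExpLA2) same left side $\Longrightarrow\langle\{\varepsilon_f\triangleq_{y_2}t_2\}\cup A;S;\{\star\triangleq_{y_1}t_1\}\cup T;\theta\{x\mapsto f(y_1,y_2)\}\rangle$. (ExpRA1) $\langle\{f(s_1,s_2)\triangleq_x\varepsilon_f\}\uplus A;S;T;\theta\rangle\Longrightarrow\langle\{s_1\triangleq_{y_1}\varepsilon_f\}\cup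 A;S;\{s_2\triangleq_{y_2}\star\}\cup T;\theta\{x\mapsto f(y_1,y_2)\}\rangle$. (ExpRA2) same left side $\Longrightarrow\langle\{s_2\triangleq_{y_2}\varepsilon_f\}\cup A;S;\{s_1\triangleq_{y_1}\star\}\cup T;\theta\{x\mapsto f(y_1,y_2)\}\rangle$. (Mer) $\langle\emptyset;\{s\triangleq_x t,s\triangleq_y t\}\cup S;T;\theta\rangle\Longrightarrow\langle\emptyset;\{s\triangleq_y t\}\cup S;T;\theta\{x\mapsto y\}\rangle$. A final configuration is one reached by a finite derivation to which no rule applies. $\sigma_W=\{y\mapsto s\mid s\triangleq_y t\in W\}$, $\rho_W=\{y\mapsto t\mid s\triangleq_y t\in W\}$. Abstraction set: $\uparrow(t,\sigma)=\{r\mid r\sigma\approx_{\mathtt{Abs}}t,\ r\ \mathtt{Abs}\text{ -normal},\ \mathcal{V}(r)\subseteq\mathit{Dom}(\sigma)\}$. $\Psi(T,S)$ is the set of substitutions $\tau$ with $\mathit{Dom}(\tau)=labels(T)$ such that $y\tau\in\uparrow(t,\rho_S)$ if $\star\triangleq_y t\in T$ and $y\tau\in\uparrow(s,\sigma_S)$ if $s\triangleq_y\star\in T$ (so $\Psi(\emptyset,S)=\{\mathrm{id}\}$). -}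

module Defs where

open import Data.Nat using (ℕ; zero; suc; _≟_)
open import Data.Bool using (if_then_else_)
open import Data.Product using (Σ; ∃; ∃-syntax; _×_; _,_; proj₁; proj₂)
open import Data.Sum using (_⊎_)
open import Data.Unit using (⊤)
open import Data.Empty using (⊥)
open import Data.List using (List; []; _∷_; _++_; map)
open import Data.List.Membership.Propositional using (_∈_; _∉_)
open import Data.List.Relation.Unary.All using (All)
open import Data.List.Relation.Unary.Unique.Propositional using (Unique)
open import Data.List.Relation.Unary.AllPairs using (AllPairs)
open import Data.List.Relation.Binary.Permutation.Propositional using (_↭_)
open import Data.Vec using (Vec; []; _∷_; toList)
open import Data.Vec.Relation.Binary.Pointwise.Inductive using (Pointwise)
open import Relation.Nullary using (¬_; does)
open import Relation.Binary.PropositionalEquality using (_≡_; _≢_)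
open import Relation.Binary.Construct.Closure.ReflexiveTransitive using (Star)

-- A ranked signature is a family  F : ℕ → Set  (F n = symbols of arity n)
-- together with the wild-card constant  ⋆ : F 0.
-- An absorption theory is given by a finite list of pairs (f , ε_f) with
-- f binary, ε_f a constant, and the f's pairwise distinct.

IsAbsTheory : (F : ℕ → Set) → List (F 2 × F 0) → Set
IsAbsTheory F Abs = AllPairs (λ p q → proj₁ p ≢ proj₁ q) Abs

module AU (F : ℕ → Set) (⋆ : F 0) (Abs : List (F 2 × F 0)) where

  data Term : Set where
    var : ℕ → Term
    app : ∀ {n} → F n → Vec Term n → Term

  ⋆ₜ : Term
  ⋆ₜ = app ⋆ []

  const : F 0 → Term
  const c = app c []

  bin : F 2 → Term → Term → Term
  bin f a b = app f (a ∷ b ∷ [])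

  data Head : Set where
    hvar : ℕ → Head
    hfun : (n : ℕ) → F n → Head

  head : Term → Head
  head (var x) = hvar x
  head (app {n} f _) = hfun n f

  Related : Head → Head → Set
  Related h h' = ∃[ p ] (p ∈ Abs ×
    ((h ≡ hfun 2 (proj₁ p) × h' ≡ hfun 0 (proj₂ p))
     ⊎ (h ≡ hfun 0 (proj₂ p) × h' ≡ hfun 2 (proj₁ p))))

  mutual
    data _∈V_ (x : ℕ) : Term → Set where
      here : x ∈V var x
      there : ∀ {n} {f : F n} {ts : Vec Term n} → x ∈Vs ts → x ∈V app f ts

    data _∈Vs_ (x : ℕ) : ∀ {n} → Vec Term n → Set where
      here : ∀ {n t} {ts : Vec Term n} → x ∈V t → x ∈Vs (t ∷ ts)
      there : ∀ {n t} {ts : Vec Term n} → x ∈Vs ts → x ∈Vs (t ∷ ts)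

  Subst : Set
  Subst = ℕ → Term

  Dom : Subst → ℕ → Set
  Dom σ x = σ x ≢ var x

  Rvar : Subst → ℕ → Set
  Rvar σ y = ∃[ x ] (Dom σ x × y ∈V σ x)

  infixl 30 _⟨_⟩ _⟨_⟩s
  infix 4 _≈A_ _⪯A_ _∈V_ _∈Vs_

  mutual
    _⟨_⟩ : Term → Subst → Term
    var x ⟨ σ ⟩ = σ x
    app f ts ⟨ σ ⟩ = app f (ts ⟨ σ ⟩s)

    _⟨_⟩s : ∀ {n} → Vec Term n → Subst → Vec Term n
    [] ⟨ σ ⟩s = []
    (t ∷ ts) ⟨ σ ⟩s = (t ⟨ σ ⟩) ∷ (ts ⟨ σ ⟩s)

  _∘ₛ_ : Subst → Subst → Subst
  (θ ∘ₛ σ) x = θ x ⟨ σ ⟩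

  [_↦_] : ℕ → Term → Subst
  [ x ↦ t ] y = if does (y ≟ x) then t else var y

  idₛ : Subst
  idₛ = var

  data _≈A_ : Term → Term → Set where
    ≈refl  : ∀ {t} → t ≈A t
    ≈sym   : ∀ {s t} → s ≈A t → t ≈A s
    ≈trans : ∀ {r s t} → r ≈A s → s ≈A t → r ≈A t
    ≈cong  : ∀ {n} (f : F n) {ss ts : Vec Term n} →
             Pointwise _≈A_ ss ts → app f ss ≈A app f ts
    ≈absR  : ∀ {f e} → (f , e) ∈ Abs → ∀ t → bin f t (const e) ≈A const e
    ≈absL  : ∀ {f e} → (f , e) ∈ Abs → ∀ t → bin f (const e) t ≈A const e

  _⪯A_ : Term → Term → Set
  r ⪯A s = ∃[ σ ] (r ⟨ σ ⟩ ≈A s)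

  _∈𝒢_,_ : Term → Term → Term → Set
  r ∈𝒢 s , t = (r ⪯A s) × (r ⪯A t)

  NoAbsArg : ∀ {n} → F n → Vec Term n → Set
  NoAbsArg {2} f (a ∷ b ∷ []) =
    ∀ e → (f , e) ∈ Abs → (a ≢ const e) × (b ≢ const e)
  NoAbsArg _ _ = ⊤

  mutual
    Normal : Term → Set
    Normal (var x) = ⊤
    Normal (app f ts) = NormalV ts × NoAbsArg f ts

    NormalV : ∀ {n} → Vec Term n → Set
    NormalV [] = ⊤
    NormalV (t ∷ ts) = Normal t × NormalV ts

  record AUE : Set where
    constructor _≜[_]_
    field
      lhs : Term
      label : ℕ
      rhs : Term
  open AUE public

  labels : List AUE → List ℕ
  labels = map label

  Valid : List AUE → Set
  Valid W = Unique (labels W)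

  Wild : AUE → Set
  Wild e = (lhs e ≡ ⋆ₜ) ⊎ (rhs e ≡ ⋆ₜ)

  Solved : AUE → Set
  Solved e = (head (lhs e) ≢ head (rhs e))
           × (¬ Related (head (lhs e)) (head (rhs e)))
           × (¬ Wild e)

  NormalAUE : AUE → Set
  NormalAUE e = Normal (lhs e) × Normal (rhs e)

  record Config : Set where
    constructor ⟨_︔_︔_︔_⟩
    field
      cA : List AUE
      cS : List AUE
      cT : List AUE
      cθ : Subst
  open Config public

  allAUE : Config → List AUE
  allAUE C = cA C ++ cS C ++ cT C

  record IsConfig (C : Config) : Set where
    field
      labelsUnique : Unique (labels (allAUE C))
      solvedS : All Solved (cS C)
      wildT : All Wild (cT C)
      normal : All NormalAUE (allAUE C)
      labelsNotDom : ∀ x → x ∈ labels (allAUE C) → ¬ Dom (cθ C) x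
      -- (the condition Rvar(θ) = labels is deliberately omitted)

  record Fresh (C : Config) (y : ℕ) : Set where
    field
      notLabel : y ∉ labels (allAUE C)
      notInLhs : All (λ e → ¬ (y ∈V lhs e)) (allAUE C)
      notInRhs : All (λ e → ¬ (y ∈V rhs e)) (allAUE C)
      notDom : ¬ Dom (cθ C) y
      notRvar : ¬ Rvar (cθ C) y

  AllFresh : Config → List ℕ → Set
  AllFresh C ys = All (Fresh C) ys × Unique ys

  zip3 : ∀ {n} → Vec Term n → Vec Term n → Vec ℕ n → List AUE
  zip3 [] [] [] = []
  zip3 (s ∷ ss) (t ∷ ts) (y ∷ ys) = (s ≜[ y ] t) ∷ zip3 ss ts ys

  varsV : ∀ {n} → Vec ℕ n → Vec Term n
  varsV [] = []
  varsV (y ∷ ys) = var y ∷ varsV ys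

  -- The rules of AUnif (sets are lists; "⊎" is expressed by a permutation)

  data _⟹_ : Config → Config → Set where
    Dec : ∀ {A A' S T θ n} (f : F n) (ss ts : Vec Term n) (x : ℕ)
            (ys : Vec ℕ n) →
          A ↭ ((app f ss ≜[ x ] app f ts) ∷ A') →
          AllFresh ⟨ A ︔ S ︔ T ︔ θ ⟩ (toList ys) →
          ⟨ A ︔ S ︔ T ︔ θ ⟩ ⟹
          ⟨ zip3 ss ts ys ++ A' ︔ S ︔ T ︔ θ ∘ₛ [ x ↦ app f (varsV ys) ] ⟩
    Sol : ∀ {A A' S T θ} (e : AUE) →
          A ↭ (e ∷ A') →
          head (lhs e) ≢ head (rhs e) →
          ¬ Related (head (lhs e)) (head (rhs e)) →
          ⟨ A ︔ S ︔ T ︔ θ ⟩ ⟹ ⟨ A' ︔ e ∷ S ︔ T ︔ θ ⟩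
    ExpLA1 : ∀ {A A' S T θ} f ε (t₁ t₂ : Term) (x y₁ y₂ : ℕ) →
          (f , ε) ∈ Abs →
          A ↭ ((const ε ≜[ x ] bin f t₁ t₂) ∷ A') →
          AllFresh ⟨ A ︔ S ︔ T ︔ θ ⟩ (y₁ ∷ y₂ ∷ []) →
          ⟨ A ︔ S ︔ T ︔ θ ⟩ ⟹
          ⟨ (const ε ≜[ y₁ ] t₁) ∷ A' ︔ S ︔ (⋆ₜ ≜[ y₂ ] t₂) ∷ T ︔
            θ ∘ₛ [ x ↦ bin f (var y₁) (var y₂) ] ⟩
    ExpLA2 : ∀ {A A' S T θ} f ε (t₁ t₂ : Term) (x y₁ y₂ : ℕ) →
          (f , ε) ∈ Abs →
          A ↭ ((const ε ≜[ x ] bin f t₁ t₂) ∷ A') →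
          AllFresh ⟨ A ︔ S ︔ T ︔ θ ⟩ (y₁ ∷ y₂ ∷ []) →
          ⟨ A ︔ S ︔ T ︔ θ ⟩ ⟹
          ⟨ (const ε ≜[ y₂ ] t₂) ∷ A' ︔ S ︔ (⋆ₜ ≜[ y₁ ] t₁) ∷ T ︔
            θ ∘ₛ [ x ↦ bin f (var y₁) (var y₂) ] ⟩
    ExpRA1 : ∀ {A A' S T θ} f ε (s₁ s₂ : Term) (x y₁ y₂ : ℕ) →
          (f , ε) ∈ Abs →
          A ↭ ((bin f s₁ s₂ ≜[ x ] const ε) ∷ A') →
          AllFresh ⟨ A ︔ S ︔ T ︔ θ ⟩ (y₁ ∷ y₂ ∷ []) →
          ⟨ A ︔ S ︔ T ︔ θ ⟩ ⟹
          ⟨ (s₁ ≜[ y₁ ] const ε) ∷ A' ︔ S ︔ (s₂ ≜[ y₂ ] ⋆ₜ) ∷ T ︔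
            θ ∘ₛ [ x ↦ bin f (var y₁) (var y₂) ] ⟩
    ExpRA2 : ∀ {A A' S T θ} f ε (s₁ s₂ : Term) (x y₁ y₂ : ℕ) →
          (f , ε) ∈ Abs →
          A ↭ ((bin f s₁ s₂ ≜[ x ] const ε) ∷ A') →
          AllFresh ⟨ A ︔ S ︔ T ︔ θ ⟩ (y₁ ∷ y₂ ∷ []) →
          ⟨ A ︔ S ︔ T ︔ θ ⟩ ⟹
          ⟨ (s₂ ≜[ y₂ ] const ε) ∷ A' ︔ S ︔ (s₁ ≜[ y₁ ] ⋆ₜ) ∷ T ︔
            θ ∘ₛ [ x ↦ bin f (var y₁) (var y₂) ] ⟩
    Mer : ∀ {S S' T θ} (s t : Term) (x y : ℕ) →
          S ↭ ((s ≜[ x ] t) ∷ (s ≜[ y ] t) ∷ S') →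
          ⟨ [] ︔ S ︔ T ︔ θ ⟩ ⟹
          ⟨ [] ︔ (s ≜[ y ] t) ∷ S' ︔ T ︔ θ ∘ₛ [ x ↦ var y ] ⟩

  _⟹*_ : Config → Config → Set
  _⟹*_ = Star _⟹_

  Final : Config → Set
  Final C = ¬ (∃[ C' ] (C ⟹ C'))

  σ[_] : List AUE → Subst
  σ[ [] ] y = var y
  σ[ e ∷ W ] y = if does (label e ≟ y) then lhs e else σ[ W ] y

  ρ[_] : List AUE → Subst
  ρ[ [] ] y = var y
  ρ[ e ∷ W ] y = if does (label e ≟ y) then rhs e else ρ[ W ] y

  _∈↑_,_ : Term → Term → Subst → Set
  r ∈↑ t , σ = (r ⟨ σ ⟩ ≈A t) × Normal r × (∀ v → v ∈V r → Dom σ v)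

  record _∈Ψ_,_ (τ : Subst) (T S : List AUE) : Set where
    field
      domSub : ∀ y → Dom τ y → y ∈ labels T
      domSup : ∀ y → y ∈ labels T → Dom τ y
      wildL : All (λ e → lhs e ≡ ⋆ₜ → τ (label e) ∈↑ rhs e , ρ[ S ]) T
      wildR : All (λ e → rhs e ≡ ⋆ₜ → τ (label e) ∈↑ lhs e , σ[ S ]) T

-- Fix a side b (left or right) and call φ a b-realiser of a configuration if
-- it sends the label of every equation of A and S, and of every wild equation
-- whose other side is ⋆, to a term Abs-equal to the b-side of that equation.
-- The invariant is: x θ φ ≈ s for every b-realiser φ. Each rule extends θ by
-- {y ↦ u}, and a realiser φ of the new configuration gives the realiser
-- {y ↦ u} φ of the old one, because u φ ≈ the b-side of the replaced equation:
-- by congruence for Dec, and for the Exp rules by the absorption axiom on the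
-- ε side and by congruence on the other side, where the new wild equation
-- ⋆ ≜ t supplies the missing argument. Freshness keeps labels pairwise
-- distinct, so {y ↦ u} disturbs no other equation. At the end A = ∅, and for
-- τ ∈ Ψ(T, S) the substitution τ σ_S (resp. τ ρ_S) is a left (resp. right)
-- realiser, which witnesses x θ τ ⪯ s (resp. t).

module Submission where

open import Defs
open import Data.Nat using (ℕ; _≟_)
open import Data.Product using (_×_; _,_; proj₁; proj₂)
open import Data.Sum using (inj₁; inj₂)
open import Data.Empty using (⊥-elim)
open import Function using (_$_)
open import Data.List using (List; []; _∷_; _++_)
open import Data.List.Properties using (++-assoc; ++-identityʳ; map-++)
open import Data.List.Membership.Propositional using (_∈_; _∉_)
open import Data.List.Membership.Propositional.Properties using (∈-++⁺ˡ; ∈-++⁺ʳ; ∈-++⁻; ∈-map⁺)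
open import Data.List.Relation.Unary.Any using (here; there)
open import Data.List.Relation.Unary.All using (lookup)
open import Data.List.Relation.Unary.All.Properties using (++⁻ˡ; ++⁻ʳ)
open import Data.List.Relation.Unary.AllPairs using ([]; _∷_)
open import Data.List.Relation.Unary.Unique.Propositional using (Unique)
open import Data.List.Relation.Unary.Unique.Propositional.Properties
  using (Unique[x∷xs]⇒x∉xs) renaming (++⁺ to Unique-++⁺)
open import Data.List.Relation.Binary.Disjoint.Propositional using (Disjoint)
open import Data.List.Relation.Binary.Permutation.Propositional
  using (_↭_; ↭-refl; ↭-sym; ↭-trans; ↭-swap; ↭-reflexive; ↭⇒↭ₛ; module PermutationReasoning)
open import Data.List.Relation.Binary.Permutation.Propositional.Properties
  using (∈-resp-↭; shift; shifts; ++⁺ˡ; ++⁺ʳ; map⁺)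
import Data.List.Relation.Binary.Permutation.Setoid.Properties as Permₛ
open import Data.Vec using (Vec; []; _∷_; toList)
open import Data.Vec.Relation.Binary.Pointwise.Inductive using (Pointwise; []; _∷_)
open import Relation.Nullary using (¬_; yes; no)
open import Relation.Nullary.Decidable using (dec-true; dec-false)
open import Relation.Binary.PropositionalEquality
  using (_≡_; _≢_; refl; sym; trans; cong; cong₂; subst; setoid; module ≡-Reasoning)
open import Relation.Binary.Construct.Closure.ReflexiveTransitive using (ε; _◅_)

module _ {A : Set} where

  Unique-resp-↭ : ∀ {xs ys : List A} → xs ↭ ys → Unique xs → Unique ys
  Unique-resp-↭ p = Permₛ.Unique-resp-↭ (setoid A) (↭⇒↭ₛ p)

  Unique-++⁻ : ∀ (xs : List A) {ys} → Unique (xs ++ ys) → Unique xs × Disjoint xs ys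
  Unique-++⁻ [] u = [] , λ { (() , _) }
  Unique-++⁻ (x ∷ xs) (x∉ ∷ u) with Unique-++⁻ xs u
  ... | uxs , disjoint = (++⁻ˡ xs x∉ ∷ uxs) , λ where
    (here refl , m) → lookup (++⁻ʳ xs x∉) m refl
    (there m′ , m) → disjoint (m′ , m)

  Unique-replace : ∀ {x : A} {xs ys zs} → xs ↭ x ∷ zs → Unique xs → Unique ys →
                   (∀ {v} → v ∈ ys → v ∉ xs) → Unique (ys ++ zs)
  Unique-replace p uxs uys fresh with Unique-resp-↭ p uxs
  ... | _ ∷ uzs = Unique-++⁺ uys uzs λ (v∈ys , v∈zs) →
    fresh v∈ys (∈-resp-↭ (↭-sym p) (there v∈zs))

module Soundness (F : ℕ → Set) (⋆ : F 0) (Abs : List (F 2 × F 0)) where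
  open AU F ⋆ Abs

  data Side : Set where
    left right : Side

  opposite : Side → Side
  opposite left = right
  opposite right = left

  select : ∀ {A : Set} → Side → A → A → A
  select left a b = a
  select right a b = b

  side : Side → AUE → Term
  side b e = select b (lhs e) (rhs e)

  sideSubst : Side → List AUE → Subst
  sideSubst left = σ[_]
  sideSubst right = ρ[_]

  mutual
    ⟨⟩-∘ₛ : ∀ (t : Term) {σ φ} → t ⟨ σ ⟩ ⟨ φ ⟩ ≡ t ⟨ σ ∘ₛ φ ⟩
    ⟨⟩-∘ₛ (var x) = refl
    ⟨⟩-∘ₛ (app f ts) = cong (app f) (⟨⟩s-∘ₛ ts)

    ⟨⟩s-∘ₛ : ∀ {n} (ts : Vec Term n) {σ φ} → ts ⟨ σ ⟩s ⟨ φ ⟩s ≡ ts ⟨ σ ∘ₛ φ ⟩s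
    ⟨⟩s-∘ₛ [] = refl
    ⟨⟩s-∘ₛ (t ∷ ts) = cong₂ _∷_ (⟨⟩-∘ₛ t) (⟨⟩s-∘ₛ ts)

  ↦-self : ∀ x u → [ x ↦ u ] x ≡ u
  ↦-self x u rewrite dec-true (x ≟ x) refl = refl

  ↦-other : ∀ {x y} u → y ≢ x → [ x ↦ u ] y ≡ var y
  ↦-other {x} {y} u y≢x rewrite dec-false (y ≟ x) y≢x = refl

  ∉Dom⇒fixed : ∀ σ x → ¬ Dom σ x → σ x ≡ var x
  ∉Dom⇒fixed σ x x∉ with σ x
  ... | app f ts = ⊥-elim (x∉ λ ())
  ... | var y with y ≟ x
  ...   | yes refl = refl
  ...   | no y≢x = ⊥-elim (x∉ λ { refl → y≢x refl })

  sideSubst-label : ∀ b {W e} → Unique (labels W) → e ∈ W → sideSubst b W (label e) ≡ side b e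
  sideSubst-label left {e ∷ W} _ (here refl) rewrite dec-true (label e ≟ label e) refl = refl
  sideSubst-label right {e ∷ W} _ (here refl) rewrite dec-true (label e ≟ label e) refl = refl
  sideSubst-label left {e′ ∷ W} {e} (e′∉ ∷ u) (there m)
    rewrite dec-false (label e′ ≟ label e) (lookup e′∉ (∈-map⁺ label m)) =
    sideSubst-label left u m
  sideSubst-label right {e′ ∷ W} {e} (e′∉ ∷ u) (there m)
    rewrite dec-false (label e′ ≟ label e) (lookup e′∉ (∈-map⁺ label m)) =
    sideSubst-label right u m

  ≈-reflexive : ∀ {s t} → s ≡ t → s ≈A t
  ≈-reflexive refl = ≈refl

  bin-cong : ∀ {f a a′ c c′} → a ≈A a′ → c ≈A c′ → bin f a c ≈A bin f a′ c′
  bin-cong {f} a≈ c≈ = ≈cong f (a≈ ∷ c≈ ∷ [])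

  absorbˡ : ∀ {f εf a c} → (f , εf) ∈ Abs → a ≈A const εf → bin f a c ≈A const εf
  absorbˡ {c = c} fε a≈ = ≈trans (bin-cong a≈ ≈refl) (≈absL fε c)

  absorbʳ : ∀ {f εf a c} → (f , εf) ∈ Abs → c ≈A const εf → bin f a c ≈A const εf
  absorbʳ {a = a} fε c≈ = ≈trans (bin-cong ≈refl c≈) (≈absR fε a)

  labels↭ : ∀ {W W′} → W ↭ W′ → labels W ↭ labels W′
  labels↭ = map⁺ label

  UniqueLabels : Config → Set
  UniqueLabels C = Unique (labels (allAUE C))

  record Realises (b : Side) (C : Config) (φ : Subst) : Set where
    field
      active : ∀ {e} → e ∈ cA C ++ cS C → φ (label e) ≈A side b e
      wild : ∀ {e} → e ∈ cT C → side (opposite b) e ≡ ⋆ₜ → φ (label e) ≈A side b e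
  open Realises

  Sound : Side → ℕ → Term → Config → Set
  Sound b x s C = ∀ φ → Realises b C φ → cθ C x ⟨ φ ⟩ ≈A s

  Sound-∘ₛ : ∀ {b x s A S T A′ S′ T′ θ} ζ →
    (∀ {φ} → Realises b ⟨ A′ ︔ S′ ︔ T′ ︔ θ ∘ₛ ζ ⟩ φ → Realises b ⟨ A ︔ S ︔ T ︔ θ ⟩ (ζ ∘ₛ φ)) →
    Sound b x s ⟨ A ︔ S ︔ T ︔ θ ⟩ → Sound b x s ⟨ A′ ︔ S′ ︔ T′ ︔ θ ∘ₛ ζ ⟩
  Sound-∘ₛ {x = x} {θ = θ} ζ pullback sound φ R =
    ≈trans (≈-reflexive (⟨⟩-∘ₛ (θ x))) (sound (ζ ∘ₛ φ) (pullback R))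

  allAUE-replace : ∀ (NA A′ S NT T : List AUE) →
                   (NA ++ A′) ++ S ++ NT ++ T ↭ (NA ++ NT) ++ A′ ++ S ++ T
  allAUE-replace NA A′ S NT T = begin
    (NA ++ A′) ++ S ++ NT ++ T   ≡⟨ ++-assoc NA A′ _ ⟩
    NA ++ A′ ++ S ++ NT ++ T     ≡⟨ cong (NA ++_) (++-assoc A′ S _) ⟨
    NA ++ (A′ ++ S) ++ NT ++ T   ↭⟨ ++⁺ˡ NA (shifts (A′ ++ S) NT) ⟩
    NA ++ NT ++ (A′ ++ S) ++ T   ≡⟨ cong (λ R → NA ++ NT ++ R) (++-assoc A′ S T) ⟩
    NA ++ NT ++ A′ ++ S ++ T     ≡⟨ ++-assoc NA NT _ ⟨
    (NA ++ NT) ++ A′ ++ S ++ T   ∎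
    where open PermutationReasoning

  UniqueLabels-replace : ∀ {A A′ S T θ E} NA NT (ys : List ℕ) →
    A ↭ E ∷ A′ → AllFresh ⟨ A ︔ S ︔ T ︔ θ ⟩ ys → labels (NA ++ NT) ↭ ys →
    UniqueLabels ⟨ A ︔ S ︔ T ︔ θ ⟩ → UniqueLabels ⟨ NA ++ A′ ︔ S ︔ NT ++ T ︔ θ ⟩
  UniqueLabels-replace {A} {A′} {S} {T} NA NT ys p (fresh , uys) new↭ys u =
    Unique-resp-↭ (↭-sym (labels↭ (allAUE-replace NA A′ S NT T)))
      (subst Unique (sym (map-++ label (NA ++ NT) _))
        (Unique-replace (labels↭ (++⁺ʳ (S ++ T) p)) u (Unique-resp-↭ (↭-sym new↭ys) uys)
          λ v∈new → Fresh.notLabel (lookup fresh (∈-resp-↭ new↭ys v∈new))))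

  label∉rest : ∀ {W E R} → W ↭ E ∷ R → Unique (labels W) → ∀ {e} → e ∈ R → label e ≢ label E
  label∉rest p u e∈R eq =
    Unique[x∷xs]⇒x∉xs (Unique-resp-↭ (labels↭ p) u) (subst (_∈ _) eq (∈-map⁺ label e∈R))

  Realises-replace : ∀ {b A A′ S T θ E u φ} NA NT → A ↭ E ∷ A′ →
    UniqueLabels ⟨ A ︔ S ︔ T ︔ θ ⟩ →
    Realises b ⟨ NA ++ A′ ︔ S ︔ NT ++ T ︔ θ ∘ₛ [ label E ↦ u ] ⟩ φ →
    u ⟨ φ ⟩ ≈A side b E →
    Realises b ⟨ A ︔ S ︔ T ︔ θ ⟩ ([ label E ↦ u ] ∘ₛ φ)
  Realises-replace {b} {A} {A′} {S} {T} {E = E} {u} {φ} NA NT p uniq R u≈E = record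
    { active = active′ ; wild = wild′ }
    where
      unchanged : ∀ {e} → e ∈ A′ ++ S ++ T → ([ label E ↦ u ] ∘ₛ φ) (label e) ≡ φ (label e)
      unchanged e∈ = cong (_⟨ φ ⟩) (↦-other u (label∉rest (++⁺ʳ (S ++ T) p) uniq e∈))

      active′ : ∀ {e} → e ∈ A ++ S → ([ label E ↦ u ] ∘ₛ φ) (label e) ≈A side b e
      active′ {e} e∈ with ∈-++⁻ A e∈
      ... | inj₂ e∈S = ≈trans (≈-reflexive (unchanged (∈-++⁺ʳ A′ (∈-++⁺ˡ e∈S))))
                               (active R (∈-++⁺ʳ (NA ++ A′) e∈S))
      ... | inj₁ e∈A with ∈-resp-↭ p e∈A
      ...   | here refl = ≈trans (≈-reflexive (cong (_⟨ φ ⟩) (↦-self (label E) u))) u≈E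
      ...   | there e∈A′ = ≈trans (≈-reflexive (unchanged (∈-++⁺ˡ e∈A′)))
                                  (active R (∈-++⁺ˡ (∈-++⁺ʳ NA e∈A′)))

      wild′ : ∀ {e} → e ∈ T → side (opposite b) e ≡ ⋆ₜ →
              ([ label E ↦ u ] ∘ₛ φ) (label e) ≈A side b e
      wild′ e∈T w = ≈trans (≈-reflexive (unchanged (∈-++⁺ʳ A′ (∈-++⁺ʳ S e∈T))))
                           (wild R (∈-++⁺ʳ NT e∈T) w)

  args-realised : ∀ b {n} (ss ts : Vec Term n) (ys : Vec ℕ n) {φ} →
    (∀ {e} → e ∈ zip3 ss ts ys → φ (label e) ≈A side b e) →
    Pointwise _≈A_ (varsV ys ⟨ φ ⟩s) (select b ss ts)
  args-realised left [] [] [] h = []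
  args-realised right [] [] [] h = []
  args-realised left (s ∷ ss) (t ∷ ts) (y ∷ ys) h =
    h (here refl) ∷ args-realised left ss ts ys (λ m → h (there m))
  args-realised right (s ∷ ss) (t ∷ ts) (y ∷ ys) h =
    h (here refl) ∷ args-realised right ss ts ys (λ m → h (there m))

  dec-realised : ∀ b {n} (f : F n) ss ts ys {φ} →
    (∀ {e} → e ∈ zip3 ss ts ys → φ (label e) ≈A side b e) →
    app f (varsV ys) ⟨ φ ⟩ ≈A select b (app f ss) (app f ts)
  dec-realised left f ss ts ys h = ≈cong f (args-realised left ss ts ys h)
  dec-realised right f ss ts ys h = ≈cong f (args-realised right ss ts ys h)

  Sound-solve : ∀ {b x s A A′ S T θ} e → A ↭ e ∷ A′ →
    Sound b x s ⟨ A ︔ S ︔ T ︔ θ ⟩ → Sound b x s ⟨ A′ ︔ e ∷ S ︔ T ︔ θ ⟩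
  Sound-solve {A = A} {A′} {S} e p sound φ R = sound φ record
    { active = λ e∈ → active R (∈-resp-↭ (↭-trans (++⁺ʳ S p) (↭-sym (shift e A′ S))) e∈)
    ; wild = wild R }

  Realises-merge : ∀ {b s t x y S S′ T θ φ} → S ↭ (s ≜[ x ] t) ∷ (s ≜[ y ] t) ∷ S′ →
    UniqueLabels ⟨ [] ︔ S ︔ T ︔ θ ⟩ →
    Realises b ⟨ [] ︔ (s ≜[ y ] t) ∷ S′ ︔ T ︔ θ ∘ₛ [ x ↦ var y ] ⟩ φ →
    Realises b ⟨ [] ︔ S ︔ T ︔ θ ⟩ ([ x ↦ var y ] ∘ₛ φ)
  Realises-merge {b} {s} {t} {x} {y} {S} {S′} {T} {φ = φ} p uniq R = record
    { active = active′ ; wild = wild′ }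
    where
      unchanged : ∀ {e} → e ∈ ((s ≜[ y ] t) ∷ S′) ++ T →
                  ([ x ↦ var y ] ∘ₛ φ) (label e) ≡ φ (label e)
      unchanged e∈ = cong (_⟨ φ ⟩) (↦-other (var y) (label∉rest (++⁺ʳ T p) uniq e∈))

      active′ : ∀ {e} → e ∈ S → ([ x ↦ var y ] ∘ₛ φ) (label e) ≈A side b e
      active′ e∈ with ∈-resp-↭ p e∈
      ... | here refl = ≈trans (≈-reflexive (cong (_⟨ φ ⟩) (↦-self x (var y))))
                               (active R (here refl))
      ... | there e∈′ = ≈trans (≈-reflexive (unchanged (∈-++⁺ˡ e∈′))) (active R e∈′)

      wild′ : ∀ {e} → e ∈ T → side (opposite b) e ≡ ⋆ₜ →
              ([ x ↦ var y ] ∘ₛ φ) (label e) ≈A side b e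
      wild′ e∈T w = ≈trans (≈-reflexive (unchanged (∈-++⁺ʳ ((s ≜[ y ] t) ∷ S′) e∈T)))
                           (wild R e∈T w)

  labels-zip3 : ∀ {n} (ss ts : Vec Term n) (ys : Vec ℕ n) → labels (zip3 ss ts ys) ≡ toList ys
  labels-zip3 [] [] [] = refl
  labels-zip3 (s ∷ ss) (t ∷ ts) (y ∷ ys) = cong (y ∷_) (labels-zip3 ss ts ys)

  ⟹-preserves-UniqueLabels : ∀ {C C′} → C ⟹ C′ → UniqueLabels C → UniqueLabels C′
  ⟹-preserves-UniqueLabels (Dec f ss ts x ys p fr) =
    UniqueLabels-replace (zip3 ss ts ys) [] (toList ys) p fr
      (↭-reflexive (trans (cong labels (++-identityʳ (zip3 ss ts ys))) (labels-zip3 ss ts ys)))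
  ⟹-preserves-UniqueLabels (Sol {A} {A′} {S} {T} e p _ _) =
    Unique-resp-↭ (labels↭ (↭-trans (++⁺ʳ (S ++ T) p) (↭-sym (shift e A′ (S ++ T)))))
  ⟹-preserves-UniqueLabels (ExpLA1 _ εf t₁ t₂ _ y₁ y₂ _ p fr) =
    UniqueLabels-replace (const εf ≜[ y₁ ] t₁ ∷ []) (⋆ₜ ≜[ y₂ ] t₂ ∷ []) (y₁ ∷ y₂ ∷ []) p fr
      ↭-refl
  ⟹-preserves-UniqueLabels (ExpLA2 _ εf t₁ t₂ _ y₁ y₂ _ p fr) =
    UniqueLabels-replace (const εf ≜[ y₂ ] t₂ ∷ []) (⋆ₜ ≜[ y₁ ] t₁ ∷ []) (y₁ ∷ y₂ ∷ []) p fr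
      (↭-swap y₂ y₁ ↭-refl)
  ⟹-preserves-UniqueLabels (ExpRA1 _ εf s₁ s₂ _ y₁ y₂ _ p fr) =
    UniqueLabels-replace (s₁ ≜[ y₁ ] const εf ∷ []) (s₂ ≜[ y₂ ] ⋆ₜ ∷ []) (y₁ ∷ y₂ ∷ []) p fr
      ↭-refl
  ⟹-preserves-UniqueLabels (ExpRA2 _ εf s₁ s₂ _ y₁ y₂ _ p fr) =
    UniqueLabels-replace (s₂ ≜[ y₂ ] const εf ∷ []) (s₁ ≜[ y₁ ] ⋆ₜ ∷ []) (y₁ ∷ y₂ ∷ []) p fr
      (↭-swap y₂ y₁ ↭-refl)
  ⟹-preserves-UniqueLabels (Mer {T = T} s t x y p) uniq
    with Unique-resp-↭ (labels↭ (++⁺ʳ T p)) uniq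
  ... | _ ∷ uniq′ = uniq′

  ⟹-preserves-Sound : ∀ {b x s C C′} → C ⟹ C′ → UniqueLabels C → Sound b x s C → Sound b x s C′
  ⟹-preserves-Sound {b} (Dec f ss ts _ ys p _) uniq =
    Sound-∘ₛ _ λ R → Realises-replace (zip3 ss ts ys) [] p uniq R $
      dec-realised b f ss ts ys λ e∈ → active R (∈-++⁺ˡ (∈-++⁺ˡ e∈))
  ⟹-preserves-Sound (Sol e p _ _) _ = Sound-solve e p
  ⟹-preserves-Sound {left} (ExpLA1 _ εf t₁ t₂ _ y₁ y₂ fε p _) uniq =
    Sound-∘ₛ _ λ R → Realises-replace (const εf ≜[ y₁ ] t₁ ∷ []) (⋆ₜ ≜[ y₂ ] t₂ ∷ []) p uniq R $
      absorbˡ fε (active R (here refl))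
  ⟹-preserves-Sound {right} (ExpLA1 _ εf t₁ t₂ _ y₁ y₂ _ p _) uniq =
    Sound-∘ₛ _ λ R → Realises-replace (const εf ≜[ y₁ ] t₁ ∷ []) (⋆ₜ ≜[ y₂ ] t₂ ∷ []) p uniq R $
      bin-cong (active R (here refl)) (wild R (here refl) refl)
  ⟹-preserves-Sound {left} (ExpLA2 _ εf t₁ t₂ _ y₁ y₂ fε p _) uniq =
    Sound-∘ₛ _ λ R → Realises-replace (const εf ≜[ y₂ ] t₂ ∷ []) (⋆ₜ ≜[ y₁ ] t₁ ∷ []) p uniq R $
      absorbʳ fε (active R (here refl))
  ⟹-preserves-Sound {right} (ExpLA2 _ εf t₁ t₂ _ y₁ y₂ _ p _) uniq =
    Sound-∘ₛ _ λ R → Realises-replace (const εf ≜[ y₂ ] t₂ ∷ []) (⋆ₜ ≜[ y₁ ] t₁ ∷ []) p uniq R $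
      bin-cong (wild R (here refl) refl) (active R (here refl))
  ⟹-preserves-Sound {left} (ExpRA1 _ εf s₁ s₂ _ y₁ y₂ _ p _) uniq =
    Sound-∘ₛ _ λ R → Realises-replace (s₁ ≜[ y₁ ] const εf ∷ []) (s₂ ≜[ y₂ ] ⋆ₜ ∷ []) p uniq R $
      bin-cong (active R (here refl)) (wild R (here refl) refl)
  ⟹-preserves-Sound {right} (ExpRA1 _ εf s₁ s₂ _ y₁ y₂ fε p _) uniq =
    Sound-∘ₛ _ λ R → Realises-replace (s₁ ≜[ y₁ ] const εf ∷ []) (s₂ ≜[ y₂ ] ⋆ₜ ∷ []) p uniq R $
      absorbˡ fε (active R (here refl))
  ⟹-preserves-Sound {left} (ExpRA2 _ εf s₁ s₂ _ y₁ y₂ _ p _) uniq =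
    Sound-∘ₛ _ λ R → Realises-replace (s₂ ≜[ y₂ ] const εf ∷ []) (s₁ ≜[ y₁ ] ⋆ₜ ∷ []) p uniq R $
      bin-cong (wild R (here refl) refl) (active R (here refl))
  ⟹-preserves-Sound {right} (ExpRA2 _ εf s₁ s₂ _ y₁ y₂ fε p _) uniq =
    Sound-∘ₛ _ λ R → Realises-replace (s₂ ≜[ y₂ ] const εf ∷ []) (s₁ ≜[ y₁ ] ⋆ₜ ∷ []) p uniq R $
      absorbʳ fε (active R (here refl))
  ⟹-preserves-Sound (Mer s t x y p) uniq = Sound-∘ₛ _ (Realises-merge p uniq)

  ⟹*-preserves-Sound : ∀ {b x s C D} → C ⟹* D → UniqueLabels C → Sound b x s C →
                       UniqueLabels D × Sound b x s D
  ⟹*-preserves-Sound ε uniq sound = uniq , sound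
  ⟹*-preserves-Sound (step ◅ steps) uniq sound =
    ⟹*-preserves-Sound steps (⟹-preserves-UniqueLabels step uniq)
      (⟹-preserves-Sound step uniq sound)

  Sound-initial : ∀ b {C e} → IsConfig C → e ∈ cA C ++ cS C → Sound b (label e) (side b e) C
  Sound-initial b {C} {e} isC e∈ φ R =
    ≈trans (≈-reflexive (cong (_⟨ φ ⟩) label-fixed)) (active R e∈)
    where
      e∈all : e ∈ allAUE C
      e∈all = subst (e ∈_) (++-assoc (cA C) (cS C) (cT C)) (∈-++⁺ˡ e∈)

      label-fixed : cθ C (label e) ≡ var (label e)
      label-fixed = ∉Dom⇒fixed (cθ C) (label e)
        (IsConfig.labelsNotDom isC (label e) (∈-map⁺ label e∈all))

  Realises-Ψ : ∀ b {S T θ τ} → τ ∈Ψ T , S → UniqueLabels ⟨ [] ︔ S ︔ T ︔ θ ⟩ →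
               Realises b ⟨ [] ︔ S ︔ T ︔ θ ⟩ (τ ∘ₛ sideSubst b S)
  Realises-Ψ b {S} {T} {θ} {τ} ψ uniq = record { active = active′ ; wild = wild′ b }
    where
      uniqS×disjoint : Unique (labels S) × Disjoint (labels S) (labels T)
      uniqS×disjoint = Unique-++⁻ (labels S) (subst Unique (map-++ label S T) uniq)

      active′ : ∀ {e} → e ∈ S → τ (label e) ⟨ sideSubst b S ⟩ ≈A side b e
      active′ {e} e∈S = ≈-reflexive (begin
        τ (label e) ⟨ sideSubst b S ⟩ ≡⟨ cong (_⟨ sideSubst b S ⟩) τ-fixes ⟩
        sideSubst b S (label e)      ≡⟨ sideSubst-label b (proj₁ uniqS×disjoint) e∈S ⟩
        side b e                     ∎)
        where
          open ≡-Reasoning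
          τ-fixes : τ (label e) ≡ var (label e)
          τ-fixes = ∉Dom⇒fixed τ (label e) λ e∈Dom →
            proj₂ uniqS×disjoint (∈-map⁺ label e∈S , _∈Ψ_,_.domSub ψ (label e) e∈Dom)

      wild′ : ∀ b′ {e} → e ∈ T → side (opposite b′) e ≡ ⋆ₜ →
              τ (label e) ⟨ sideSubst b′ S ⟩ ≈A side b′ e
      wild′ left e∈T w = proj₁ (lookup (_∈Ψ_,_.wildR ψ) e∈T w)
      wild′ right e∈T w = proj₁ (lookup (_∈Ψ_,_.wildL ψ) e∈T w)

  Sound⇒⪯A : ∀ b {x s τ} D → cA D ≡ [] → UniqueLabels D → Sound b x s D →
             τ ∈Ψ cT D , cS D → (var x ⟨ cθ D ⟩ ⟨ τ ⟩) ⪯A s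
  Sound⇒⪯A b {x} {s} ⟨ .[] ︔ S ︔ T ︔ θ ⟩ refl uniq sound ψ =
    sideSubst b S , ≈trans (≈-reflexive (⟨⟩-∘ₛ (θ x))) (sound _ (Realises-Ψ b ψ uniq))

theorem3 : (F : ℕ → Set) (⋆ : F 0) (Abs : List (F 2 × F 0)) →
    IsAbsTheory F Abs →
    let open AU F ⋆ Abs in
    (C₀ Cₙ : Config) →
    IsConfig C₀ →
    C₀ ⟹* Cₙ →
    cA Cₙ ≡ [] →
    Final Cₙ →
    (e : AUE) → e ∈ cA C₀ ++ cS C₀ →
    (τ : Subst) → τ ∈Ψ cT Cₙ , cS Cₙ →
    (var (label e) ⟨ cθ Cₙ ⟩ ⟨ τ ⟩) ∈𝒢 lhs e , rhs e
theorem3 F ⋆ Abs _ C₀ Cₙ isC₀ steps A≡[] _ e e∈ τ ψ = generalises left , generalises right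
  where
    open AU F ⋆ Abs
    open Soundness F ⋆ Abs

    generalises : ∀ b → (var (label e) ⟨ cθ Cₙ ⟩ ⟨ τ ⟩) ⪯A side b e
    generalises b
      with ⟹*-preserves-Sound steps (IsConfig.labelsUnique isC₀) (Sound-initial b isC₀ e∈)
    ... | uniq , sound = Sound⇒⪯A b Cₙ A≡[] uniq sound ψ
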